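{- Let $R$ be a region with $n$ cells, $n$ a multiple of $3$, let $P\subseteq R$ be a set of $k=n/3$ peg cells, and let $G$ be the region network of $(R,P)$. If the value of a maximum flow in $G$ equals $n/3$, then $(R,P)$ has a p-cover.
   Context: A cell is a unit square $[x,x+1]\times[y,y+1]$, $x,y\in\mathbb Z$; it lies in row $y$. A region is a finite union of cells with connected interior; two cells are adjacent if their Manhattan distance is $1$. A tromino is an L-shaped set of three cells: a corner cell plus two tips adjacent to it, one horizontally and one vertically. A p-cover of $(R,P)$ is a set of pairwise non-overlapping trominoes contained in $R$ covering all cells of $R$, each with its corner cell in $P$ and its tips outside $P$. Region network: color a cell black if its row is even and white if odd; let $B$ be the black cells not in $P$ and $W$ the white cells not in $P$. $G$ has a vertex for each cell of $R$ plus a source $s$ and sink $t$; directed edges $s\to b$ for each $b\in B$; $w\to t$ for each $w\in W$; $b\to p$ for $b\in B$, $p\in P$ adjacent in $R$; $p\to w$ for $p\in P$, $w\in W$ adjacent in $R$. All edges have capacity $1$; every cell vertex has vertex capacity $1$, and $s,t$ have infinite capacity. A flow is a function $f:E(G)\to\mathbb N$ respecting edge capacities, with total flow entering each vertex at most its vertex capacity, and with flow conservation at every vertex other than $s,t$; its value is $|f|=\sum_v f(s,v)$. -}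

module Defs where

open import Data.Integer using (ℤ; ∣_∣; _-_; +_; -[1+_]) renaming (_+_ to _+ℤ_)
open import Data.Integer.Divisibility using () renaming (_∣_ to _∣ℤ_)
open import Data.Nat using (ℕ; _+_; _≤_)
open import Data.Product using (_×_; _,_; Σ; ∃; proj₁; proj₂)
open import Data.List using (List; []; _∷_; map; concatMap)
open import Data.Nat.ListAction using (sum)
open import Data.List.Membership.Propositional using (_∈_; _∉_)
open import Data.List.Relation.Unary.Unique.Propositional using (Unique)
open import Data.List.Relation.Unary.All using (All)
open import Relation.Nullary using (¬_)
open import Relation.Binary.PropositionalEquality using (_≡_)

-- A cell [x,x+1]×[y,y+1] is represented by its lower-left corner (x , y);
-- it lies in row y.
Cell : Set
Cell = ℤ × ℤ

row : Cell → ℤ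
row = proj₂

Adjacent : Cell → Cell → Set
Adjacent (x₁ , y₁) (x₂ , y₂) = ∣ x₁ - x₂ ∣ + ∣ y₁ - y₂ ∣ ≡ 1

data Path (R : List Cell) : Cell → Cell → Set where
  here : ∀ {a} → Path R a a
  step : ∀ {a b c} → Adjacent a b → b ∈ R → Path R b c → Path R a c

-- A region: a finite set of cells (duplicate-free list) with connected
-- interior, i.e. any two of its cells are joined by an adjacency path in R.
IsRegion : List Cell → Set
IsRegion R = Unique R × (∀ {a b} → a ∈ R → b ∈ R → Path R a b)

data Sign : Set where
  plus minus : Sign

sgn : Sign → ℤ
sgn plus  = + 1
sgn minus = -[1+ 0 ]

-- corner cell, plus the horizontal tip (x ± 1 , y) and vertical tip (x , y ± 1)
record Tromino : Set where
  constructor tromino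
  field
    corner : Cell
    hdir   : Sign
    vdir   : Sign

tipH : Tromino → Cell
tipH (tromino (x , y) h v) = (x +ℤ sgn h , y)

tipV : Tromino → Cell
tipV (tromino (x , y) h v) = (x , y +ℤ sgn v)

cells : Tromino → List Cell
cells t = Tromino.corner t ∷ tipH t ∷ tipV t ∷ []

IsPCover : List Cell → List Cell → List Tromino → Set
IsPCover R P T =
  Unique (concatMap cells T)
  × (∀ {t} → t ∈ T → All (_∈ R) (cells t))
  × (∀ {c} → c ∈ R → Σ Tromino (λ t → t ∈ T × c ∈ cells t))
  × (∀ {t} → t ∈ T → (Tromino.corner t ∈ P) × (tipH t ∉ P) × (tipV t ∉ P))

HasPCover : List Cell → List Cell → Set
HasPCover R P = Σ (List Tromino) (IsPCover R P)

Black : Cell → Set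
Black c = + 2 ∣ℤ row c

White : Cell → Set
White c = ¬ Black c

InB : List Cell → List Cell → Cell → Set
InB R P c = c ∈ R × c ∉ P × Black c

InW : List Cell → List Cell → Cell → Set
InW R P c = c ∈ R × c ∉ P × White c

data Vertex : Set where
  src snk : Vertex
  cellv   : Cell → Vertex

data Edge (R P : List Cell) : Vertex → Vertex → Set where
  s→b : ∀ {b} → InB R P b → Edge R P src (cellv b)
  w→t : ∀ {w} → InW R P w → Edge R P (cellv w) snk
  b→p : ∀ {b p} → InB R P b → p ∈ P → p ∈ R → Adjacent b p → Edge R P (cellv b) (cellv p)
  p→w : ∀ {p w} → p ∈ P → p ∈ R → InW R P w → Adjacent p w → Edge R P (cellv p) (cellv w)

vertices : List Cell → List Vertex
vertices R = src ∷ snk ∷ map cellv R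

-- A flow is given as f u v on every ordered pair of vertices, required to be
-- 0 on non-edges.
inflow : List Cell → (Vertex → Vertex → ℕ) → Vertex → ℕ
inflow R f v = sum (map (λ u → f u v) (vertices R))

outflow : List Cell → (Vertex → Vertex → ℕ) → Vertex → ℕ
outflow R f v = sum (map (λ w → f v w) (vertices R))

record IsFlow (R P : List Cell) (f : Vertex → Vertex → ℕ) : Set where
  field
    edgeCap   : ∀ u v → Edge R P u v → f u v ≤ 1
    nonEdge   : ∀ u v → ¬ Edge R P u v → f u v ≡ 0
    vertexCap : ∀ c → c ∈ R → inflow R f (cellv c) ≤ 1
    conserve  : ∀ c → c ∈ R → inflow R f (cellv c) ≡ outflow R f (cellv c)

value : List Cell → (Vertex → Vertex → ℕ) → ℕ
value R f = sum (map (f src) (vertices R))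

MaxFlowValue : List Cell → List Cell → ℕ → Set
MaxFlowValue R P m =
  Σ (Vertex → Vertex → ℕ) (λ f → IsFlow R P f × value R f ≡ m)
  × (∀ f → IsFlow R P f → value R f ≤ m)

module Submission where

-- Every unit of flow leaves the source through a black non-peg cell b,
-- and by conservation continues along edges b → p → w → t, where p is a peg
-- and w a white non-peg cell.  Since b is black and w is white, one of them is
-- the horizontal and the other the vertical neighbour of p, so {b , p , w} is
-- an L-tromino with corner p and tips outside P.  Vertex capacity 1 forces
-- paths from distinct sources to be vertex-disjoint, so the k saturated
-- sources give k pairwise disjoint trominoes in R; their 3k = |R| cells must
-- then cover R (pigeonhole).

open import Defs
open import Data.Nat using (ℕ; zero; suc; _+_; _*_; _≤_; s≤s; z≤n; _≤?_) renaming (_≟_ to _≟ℕ_)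
open import Data.Nat.Properties
  using (≤-trans; ≤-reflexive; +-mono-≤; m≤m+n; m≤n+m; ≤-antisym; ≰⇒>; n<1⇒n≡0; <-irrefl; *-suc; suc-injective)
open import Data.Nat.ListAction using (sum)
import Data.Nat.Divisibility as ℕ∣
open import Data.Integer using (ℤ; ∣_∣; _-_; +_; -[1+_]) renaming (_+_ to _+ℤ_)
import Data.Integer as Int
open import Data.Integer.Properties using (∣i∣≡0⇒i≡0; ∣-i∣≡∣i∣; +-identityˡ; +-identityʳ; +-inverseʳ)
open import Data.Integer.DivMod using (a≡a%ℕn+[a/ℕn]*n; n%ℕd<d; _%ℕ_; _/ℕ_)
import Data.Integer.Divisibility.Signed as Signed
open import Data.Integer.Divisibility using () renaming (_∣_ to _∣ℤ_)
open import Data.Integer.Solver using (module +-*-Solver)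
open +-*-Solver using (solve; _:=_; _:+_; _:-_; _:*_; :-_; con)
open import Data.List using (List; []; _∷_; map; length; filter; concatMap)
open import Data.List.Properties using (length-map; concatMap-map; map-∘; length-removeAt′)
open import Data.List.Membership.Propositional using (_∈_; _∉_; mapWith∈; find)
open import Data.List.Membership.Propositional.Properties
  using (∈-map⁺; ∈-map⁻; ∈-filter⁻; ∈-concatMap⁻; map-mapWith∈; mapWith∈-id)
open import Data.List.Relation.Unary.Any using (here; there; any?; index; _─_)
open import Data.List.Relation.Unary.All using (All; []; _∷_)
import Data.List.Relation.Unary.All as All
import Data.List.Relation.Unary.All.Properties as All
open import Data.List.Relation.Unary.AllPairs using ([]; _∷_)
import Data.List.Relation.Unary.AllPairs as AllPairs
import Data.List.Relation.Unary.AllPairs.Properties as AllPairs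
open import Data.List.Relation.Unary.Unique.Propositional using (Unique)
import Data.List.Relation.Unary.Unique.Propositional.Properties as Unique
open import Data.List.Relation.Binary.Subset.Propositional using (_⊆_)
open import Data.List.Relation.Binary.Disjoint.Propositional using (Disjoint)
open import Data.Product using (Σ; ∃-syntax; _×_; _,_; proj₁; proj₂)
open import Data.Product.Properties using (≡-dec)
open import Data.Sum using (_⊎_; inj₁; inj₂)
open import Data.Empty using (⊥; ⊥-elim)
open import Function using (_∘_)
open import Relation.Nullary using (¬_; Dec; yes; no; ¬?; contradiction)
open import Relation.Nullary.Decidable using (_×-dec_; _⊎-dec_; map′)
open import Relation.Unary using (Decidable)
open import Relation.Binary.Definitions using (DecidableEquality)
open import Relation.Binary.PropositionalEquality
  using (_≡_; _≢_; refl; sym; trans; cong; cong₂; subst; ≢-sym; module ≡-Reasoning)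

module _ {A : Set} (g : A → ℕ) where

  term≤sum : ∀ {x} xs → x ∈ xs → g x ≤ sum (map g xs)
  term≤sum (y ∷ ys) (here refl) = m≤m+n (g y) _
  term≤sum (y ∷ ys) (there x∈)  = ≤-trans (term≤sum ys x∈) (m≤n+m _ (g y))

  positive-term : ∀ xs → 1 ≤ sum (map g xs) → ∃[ x ] x ∈ xs × 1 ≤ g x
  positive-term (x ∷ xs) pos with 1 ≤? g x
  ... | yes gx≥1 = x , here refl , gx≥1
  ... | no gx≱1 with positive-term xs (subst (λ n → 1 ≤ n + sum (map g xs)) (n<1⇒n≡0 (≰⇒> gx≱1)) pos)
  ...   | y , y∈ , gy≥1 = y , there y∈ , gy≥1

  positive-term-unique : ∀ {x y} xs → sum (map g xs) ≤ 1 → x ∈ xs → y ∈ xs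
                       → 1 ≤ g x → 1 ≤ g y → x ≡ y
  positive-term-unique (z ∷ zs) _ (here refl) (here refl) _ _ = refl
  positive-term-unique (z ∷ zs) s≤1 (here refl) (there y∈) gz≥1 gy≥1 =
    ⊥-elim (<-irrefl refl (≤-trans (+-mono-≤ gz≥1 (≤-trans gy≥1 (term≤sum zs y∈))) s≤1))
  positive-term-unique (z ∷ zs) s≤1 (there x∈) (here refl) gx≥1 gz≥1 =
    ⊥-elim (<-irrefl refl (≤-trans (+-mono-≤ gz≥1 (≤-trans gx≥1 (term≤sum zs x∈))) s≤1))
  positive-term-unique (z ∷ zs) s≤1 (there x∈) (there y∈) =
    positive-term-unique zs (≤-trans (m≤n+m _ (g z)) s≤1) x∈ y∈

  count-positive : (positive? : Decidable (λ x → 1 ≤ g x)) → ∀ xs → (∀ {x} → x ∈ xs → g x ≤ 1)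
                 → length (filter positive? xs) ≡ sum (map g xs)
  count-positive positive? [] _ = refl
  count-positive positive? (x ∷ xs) ≤1 with positive? x
  ... | yes gx≥1 = cong₂ _+_ (≤-antisym gx≥1 (≤1 (here refl))) (count-positive positive? xs (≤1 ∘ there))
  ... | no gx≱1 = trans (count-positive positive? xs (≤1 ∘ there))
                        (cong (_+ sum (map g xs)) (sym (n<1⇒n≡0 (≰⇒> gx≱1))))

module _ {A : Set} where

  image-property : ∀ {B : Set} (Q : B → Set) (h : A → B) {xs : List A}
                 → (∀ x → Q (h x)) → ∀ {y} → y ∈ map h xs → Q y
  image-property Q h Qh y∈ with ∈-map⁻ h y∈
  ... | x , _ , y≡hx = subst Q (sym y≡hx) (Qh x)

  ∈-─ : ∀ {x y} {ys : List A} (x∈ : x ∈ ys) → y ∈ ys → y ≢ x → y ∈ (ys ─ x∈)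
  ∈-─ (here refl) (here refl) y≢x = ⊥-elim (y≢x refl)
  ∈-─ (here refl) (there y∈)  _   = y∈
  ∈-─ (there x∈)  (here refl) _   = here refl
  ∈-─ (there x∈)  (there y∈)  y≢x = there (∈-─ x∈ y∈ y≢x)

  unique-length-≤ : ∀ {xs ys : List A} → Unique xs → xs ⊆ ys → length xs ≤ length ys
  unique-length-≤ {[]} _ _ = z≤n
  unique-length-≤ {x ∷ xs} {ys} (x∉xs ∷ unique) xs⊆ys =
    subst (suc (length xs) ≤_) (sym (length-removeAt′ ys (index x∈ys)))
      (s≤s (unique-length-≤ unique λ z∈ →
        ∈-─ x∈ys (xs⊆ys (there z∈)) (≢-sym (All.lookup x∉xs z∈))))
    where
      x∈ys : x ∈ ys
      x∈ys = xs⊆ys (here refl)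

  unique-long-⊇ : DecidableEquality A → ∀ {xs ys : List A}
                → Unique xs → xs ⊆ ys → length ys ≤ length xs → ys ⊆ xs
  unique-long-⊇ _≟_ {xs} {ys} unique xs⊆ys |ys|≤|xs| {y} y∈ys with any? (y ≟_) xs
  ... | yes y∈xs = y∈xs
  ... | no y∉xs = ⊥-elim (<-irrefl refl (≤-trans longer |ys|≤|xs|))
    where
      longer : suc (length xs) ≤ length ys
      longer = unique-length-≤ (All.tabulate (λ z∈ y≡z → y∉xs (subst (_∈ xs) (sym y≡z) z∈)) ∷ unique)
                 λ { (here refl) → y∈ys ; (there z∈) → xs⊆ys z∈ }

  concatMap-unique : ∀ {K B : Set} (key : A → K) (g : A → List B) {xs : List A}
                   → (∀ x → Unique (g x)) → (∀ x y → key x ≢ key y → Disjoint (g x) (g y))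
                   → Unique (map key xs) → Unique (concatMap g xs)
  concatMap-unique key g each disjoint keys-unique =
    Unique.concat⁺ (All.map⁺ (All.tabulate λ {x} _ → each x))
                   (AllPairs.map⁺ (AllPairs.map (λ {x} {y} → disjoint x y) (AllPairs.map⁻ keys-unique)))

_≟ᶜ_ : DecidableEquality Cell
_≟ᶜ_ = ≡-dec Int._≟_ Int._≟_

sgn≢0 : ∀ s → sgn s ≢ + 0
sgn≢0 plus ()
sgn≢0 minus ()

shift-≢ : ∀ i s → i +ℤ sgn s ≢ i
shift-≢ i s eq = sgn≢0 s (begin
  sgn s               ≡⟨ solve 2 (λ i s → s := (i :+ s) :- i) refl i (sgn s) ⟩
  (i +ℤ sgn s) - i    ≡⟨ cong (_- i) eq ⟩
  i - i               ≡⟨ +-inverseʳ i ⟩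
  + 0                 ∎)
  where open ≡-Reasoning

tromino-cells-unique : ∀ t → Unique (cells t)
tromino-cells-unique (tromino (x , y) h v) =
  ((λ e → shift-≢ x h (sym (cong proj₁ e))) ∷ (λ e → shift-≢ y v (sym (cong proj₂ e))) ∷ [])
  ∷ ((λ e → shift-≢ x h (cong proj₁ e)) ∷ []) ∷ [] ∷ []

unit-vector : ∀ d e → ∣ d ∣ + ∣ e ∣ ≡ 1
            → (∃[ s ] d ≡ sgn s × e ≡ + 0) ⊎ (d ≡ + 0 × ∃[ s ] e ≡ sgn s)
unit-vector (+ zero)       (+ suc zero)   refl = inj₂ (refl , plus , refl)
unit-vector (+ zero)       -[1+ zero ]    refl = inj₂ (refl , minus , refl)
unit-vector (+ suc zero)   e              h    = inj₁ (plus , refl , ∣i∣≡0⇒i≡0 (suc-injective h))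
unit-vector -[1+ zero ]    e              h    = inj₁ (minus , refl , ∣i∣≡0⇒i≡0 (suc-injective h))
unit-vector (+ zero)       (+ zero)       ()
unit-vector (+ zero)       (+ suc (suc n)) ()
unit-vector (+ zero)       -[1+ suc n ]   ()
unit-vector (+ suc (suc n)) e             ()
unit-vector -[1+ suc n ]   e              ()

add-difference : ∀ a b → a ≡ b +ℤ (a - b)
add-difference = solve 2 (λ a b → a := b :+ (a :- b)) refl

neighbour-cases : ∀ a c → Adjacent a c
                → (∃[ s ] a ≡ (proj₁ c +ℤ sgn s , proj₂ c)) ⊎ (∃[ s ] a ≡ (proj₁ c , proj₂ c +ℤ sgn s))
neighbour-cases (x₁ , y₁) (x₂ , y₂) adj with unit-vector (x₁ - x₂) (y₁ - y₂) adj
... | inj₁ (s , dx , dy) =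
  inj₁ (s , cong₂ _,_ (trans (add-difference x₁ x₂) (cong (x₂ +ℤ_) dx))
                      (trans (add-difference y₁ y₂) (trans (cong (y₂ +ℤ_) dy) (+-identityʳ y₂))))
... | inj₂ (dx , s , dy) =
  inj₂ (s , cong₂ _,_ (trans (add-difference x₁ x₂) (trans (cong (x₂ +ℤ_) dx) (+-identityʳ x₂)))
                      (trans (add-difference y₁ y₂) (cong (y₂ +ℤ_) dy)))

adjacent-sym : ∀ a c → Adjacent a c → Adjacent c a
adjacent-sym (x₁ , y₁) (x₂ , y₂) adj = trans (cong₂ _+_ (dist-sym x₂ x₁) (dist-sym y₂ y₁)) adj
  where
    dist-sym : ∀ i j → ∣ i - j ∣ ≡ ∣ j - i ∣
    dist-sym i j = trans (sym (∣-i∣≡∣i∣ (i - j)))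
                         (cong ∣_∣ (solve 2 (λ i j → :- (i :- j) := j :- i) refl i j))

EvenRow : ℤ → Set
EvenRow y = + 2 ∣ℤ y

even? : ∀ y → Dec (EvenRow y)
even? y = 2 ℕ∣.∣? ∣ y ∣

neighbour-rows-not-both-even : ∀ y s → EvenRow y → EvenRow (y +ℤ sgn s) → ⊥
neighbour-rows-not-both-even y s 2∣y 2∣y+s = two∤one (subst (2 ℕ∣.∣_) (∣sgn∣ s)
  (Signed.∣⇒∣ᵤ {+ 2} (Signed.∣m+n∣m⇒∣n {+ 2} {y} (Signed.∣ᵤ⇒∣ {+ 2} 2∣y+s) (Signed.∣ᵤ⇒∣ {+ 2} 2∣y))))
  where
    two∤one : ¬ (2 ℕ∣.∣ 1)
    two∤one 2∣1 with ℕ∣.∣1⇒≡1 2∣1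
    ... | ()
    ∣sgn∣ : ∀ s → ∣ sgn s ∣ ≡ 1
    ∣sgn∣ plus = refl
    ∣sgn∣ minus = refl

even-intro : ∀ y q → y ≡ q Int.* + 2 → EvenRow y
even-intro y q eq = Signed.∣⇒∣ᵤ (Signed.divides q eq)

neighbour-rows-not-both-odd : ∀ y s → ¬ EvenRow y → ¬ EvenRow (y +ℤ sgn s) → ⊥
neighbour-rows-not-both-odd y s odd-y odd-y+s
  with y %ℕ 2 | n%ℕd<d y 2 | a≡a%ℕn+[a/ℕn]*n y 2
... | 0 | _ | y≡2q = odd-y (even-intro y (y /ℕ 2) (trans y≡2q (+-identityˡ _)))
... | 1 | _ | y≡1+2q with s
...   | plus = odd-y+s (even-intro _ (y /ℕ 2 +ℤ + 1) (trans (cong (_+ℤ + 1) y≡1+2q)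
        (solve 1 (λ q → (con (+ 1) :+ q :* con (+ 2)) :+ con (+ 1) := (q :+ con (+ 1)) :* con (+ 2))
               refl (y /ℕ 2))))
...   | minus = odd-y+s (even-intro _ (y /ℕ 2) (trans (cong (_+ℤ -[1+ 0 ]) y≡1+2q)
        (solve 1 (λ q → (con (+ 1) :+ q :* con (+ 2)) :+ con -[1+ 0 ] := q :* con (+ 2))
               refl (y /ℕ 2))))
neighbour-rows-not-both-odd y s _ _ | suc (suc _) | s≤s (s≤s ()) | _

LShape : Tromino → Cell → Cell → Cell → Set
LShape t p a b = Tromino.corner t ≡ p × ((tipH t ≡ a × tipV t ≡ b) ⊎ (tipH t ≡ b × tipV t ≡ a))

lshape-⊆ : ∀ {t p a b} → LShape t p a b → cells t ⊆ a ∷ p ∷ b ∷ []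
lshape-⊆ (refl , _)              (here refl)                 = there (here refl)
lshape-⊆ (_ , inj₁ (refl , _))   (there (here refl))         = here refl
lshape-⊆ (_ , inj₂ (refl , _))   (there (here refl))         = there (there (here refl))
lshape-⊆ (_ , inj₁ (_ , refl))   (there (there (here refl))) = there (there (here refl))
lshape-⊆ (_ , inj₂ (_ , refl))   (there (there (here refl))) = here refl

lshape-tips : ∀ {t p a b} (Q : Cell → Set) → LShape t p a b → Q a → Q b → Q (tipH t) × Q (tipV t)
lshape-tips Q (_ , inj₁ (refl , refl)) qa qb = qa , qb
lshape-tips Q (_ , inj₂ (refl , refl)) qa qb = qb , qa

-- Key geometric fact: a black cell b and a white cell w both adjacent to p
-- lie in different directions from p, so they form an L-tromino with corner p.
-- (If p is in an even row, b is in p's row and w is above or below it;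
-- if p is in an odd row, it is the other way round.)
l-tromino : ∀ b p w → Black b → Adjacent b p → White w → Adjacent w p → Σ Tromino λ t → LShape t p b w
l-tromino b (x , y) w b-black b~p w-white w~p
  with even? y | neighbour-cases b (x , y) b~p | neighbour-cases w (x , y) w~p
... | yes _      | inj₁ (s , refl) | inj₂ (s′ , refl) = tromino (x , y) s s′ , refl , inj₁ (refl , refl)
... | no _       | inj₂ (s , refl) | inj₁ (s′ , refl) = tromino (x , y) s′ s , refl , inj₂ (refl , refl)
... | yes y-even | inj₂ (s , refl) | _                = ⊥-elim (neighbour-rows-not-both-even y s y-even b-black)
... | yes y-even | inj₁ _          | inj₁ (_ , refl)  = ⊥-elim (w-white y-even)
... | no y-odd   | inj₁ (_ , refl) | _                = ⊥-elim (y-odd b-black)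
... | no y-odd   | inj₂ _          | inj₂ (s′ , refl) = ⊥-elim (neighbour-rows-not-both-odd y s′ y-odd w-white)

module RegionFlow (R P : List Cell) (f : Vertex → Vertex → ℕ) (isFlow : IsFlow R P f)
                  (unique-R : Unique R) where
  open IsFlow isFlow
  open import Data.List.Membership.DecPropositional _≟ᶜ_ using (_∈?_)

  inB? : ∀ c → Dec (InB R P c)
  inB? c = (c ∈? R) ×-dec (¬? (c ∈? P) ×-dec even? (row c))

  inW? : ∀ c → Dec (InW R P c)
  inW? c = (c ∈? R) ×-dec (¬? (c ∈? P) ×-dec ¬? (even? (row c)))

  adjacent? : ∀ a c → Dec (Adjacent a c)
  adjacent? (x₁ , y₁) (x₂ , y₂) = ∣ x₁ - x₂ ∣ + ∣ y₁ - y₂ ∣ ≟ℕ 1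

  edge? : ∀ u v → Dec (Edge R P u v)
  edge? src       (cellv b) = map′ s→b (λ { (s→b b∈B) → b∈B }) (inB? b)
  edge? (cellv w) snk       = map′ w→t (λ { (w→t w∈W) → w∈W }) (inW? w)
  edge? (cellv a) (cellv c) =
    map′ (λ { (inj₁ (a∈B , c∈P , c∈R , a~c)) → b→p a∈B c∈P c∈R a~c
            ; (inj₂ (a∈P , a∈R , c∈W , a~c)) → p→w a∈P a∈R c∈W a~c })
         (λ { (b→p a∈B c∈P c∈R a~c) → inj₁ (a∈B , c∈P , c∈R , a~c)
            ; (p→w a∈P a∈R c∈W a~c) → inj₂ (a∈P , a∈R , c∈W , a~c) })
         ((inB? a ×-dec ((c ∈? P) ×-dec ((c ∈? R) ×-dec adjacent? a c)))
          ⊎-dec ((a ∈? P) ×-dec ((a ∈? R) ×-dec (inW? c ×-dec adjacent? a c))))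
  edge? src       src       = no λ ()
  edge? src       snk       = no λ ()
  edge? snk       _         = no λ ()
  edge? (cellv _) src       = no λ ()

  flow⇒edge : ∀ u v → 1 ≤ f u v → Edge R P u v
  flow⇒edge u v pos with edge? u v
  ... | yes e = e
  ... | no ¬e = contradiction (subst (1 ≤_) (nonEdge u v ¬e) pos) λ ()

  cellv∈ : ∀ {c} → c ∈ R → cellv c ∈ vertices R
  cellv∈ c∈R = there (there (∈-map⁺ cellv c∈R))

  cellv-injective : ∀ {a c} → cellv a ≡ cellv c → a ≡ c
  cellv-injective refl = refl

  flow-continues : ∀ {u c} → c ∈ R → u ∈ vertices R → 1 ≤ f u (cellv c)
                 → ∃[ v ] v ∈ vertices R × 1 ≤ f (cellv c) v
  flow-continues {u} {c} c∈R u∈V pos =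
    positive-term (f (cellv c)) (vertices R)
      (subst (1 ≤_) (conserve c c∈R) (≤-trans pos (term≤sum (λ v → f v (cellv c)) (vertices R) u∈V)))

  unique-predecessor : ∀ {u u′ c} → c ∈ R → u ∈ vertices R → u′ ∈ vertices R
                     → 1 ≤ f u (cellv c) → 1 ≤ f u′ (cellv c) → u ≡ u′
  unique-predecessor {c = c} c∈R =
    positive-term-unique (λ v → f v (cellv c)) (vertices R) (vertexCap c c∈R)

  record FlowPath (b : Cell) : Set where
    field
      peg white   : Cell
      b∈B         : InB R P b
      peg∈P       : peg ∈ P
      peg∈R       : peg ∈ R
      white∈W     : InW R P white
      flow-b-peg  : 1 ≤ f (cellv b) (cellv peg)
      flow-peg-w  : 1 ≤ f (cellv peg) (cellv white)
      b~peg       : Adjacent b peg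
      peg~white   : Adjacent peg white
  open FlowPath

  trace : ∀ {b} → 1 ≤ f src (cellv b) → FlowPath b
  trace {b} pos with flow⇒edge _ _ pos
  ... | s→b b∈B with flow-continues (proj₁ b∈B) (here refl) pos
  ... | v , _ , pos₁ with flow⇒edge _ _ pos₁
  ... | w→t (_ , _ , not-black) = ⊥-elim (not-black (proj₂ (proj₂ b∈B)))
  ... | p→w b∈P _ _ _ = ⊥-elim (proj₁ (proj₂ b∈B) b∈P)
  ... | b→p {p = p} _ p∈P p∈R b~p with flow-continues p∈R (cellv∈ (proj₁ b∈B)) pos₁
  ... | v′ , _ , pos₂ with flow⇒edge _ _ pos₂
  ... | w→t (_ , p∉P , _) = ⊥-elim (p∉P p∈P)
  ... | b→p (_ , p∉P , _) _ _ _ = ⊥-elim (p∉P p∈P)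
  ... | p→w {w = w} _ _ w∈W p~w = record
    { peg = p ; white = w ; b∈B = b∈B ; peg∈P = p∈P ; peg∈R = p∈R ; white∈W = w∈W
    ; flow-b-peg = pos₁ ; flow-peg-w = pos₂ ; b~peg = b~p ; peg~white = p~w }

  Route : Set
  Route = Σ Cell FlowPath

  source : Route → Cell
  source = proj₁

  pathCells : Route → List Cell
  pathCells (b , π) = b ∷ peg π ∷ white π ∷ []

  pathCells⊆R : ∀ x → pathCells x ⊆ R
  pathCells⊆R (b , π) (here refl)                 = proj₁ (b∈B π)
  pathCells⊆R (b , π) (there (here refl))         = peg∈R π
  pathCells⊆R (b , π) (there (there (here refl))) = proj₁ (white∈W π)

  same-peg⇒same-source : ∀ {b b′} (π : FlowPath b) (π′ : FlowPath b′) → peg π ≡ peg π′ → b ≡ b′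
  same-peg⇒same-source π π′ eq = cellv-injective
    (unique-predecessor (peg∈R π) (cellv∈ (proj₁ (b∈B π))) (cellv∈ (proj₁ (b∈B π′)))
      (flow-b-peg π) (subst (λ q → 1 ≤ f _ (cellv q)) (sym eq) (flow-b-peg π′)))

  same-white⇒same-peg : ∀ {b b′} (π : FlowPath b) (π′ : FlowPath b′) → white π ≡ white π′ → peg π ≡ peg π′
  same-white⇒same-peg π π′ eq = cellv-injective
    (unique-predecessor (proj₁ (white∈W π)) (cellv∈ (peg∈R π)) (cellv∈ (peg∈R π′))
      (flow-peg-w π) (subst (λ q → 1 ≤ f _ (cellv q)) (sym eq) (flow-peg-w π′)))

  B∩P : ∀ {c} → InB R P c → c ∉ P
  B∩P = proj₁ ∘ proj₂

  W∩P : ∀ {c} → InW R P c → c ∉ P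
  W∩P = proj₁ ∘ proj₂

  B∩W : ∀ {c} → InB R P c → ¬ InW R P c
  B∩W c∈B c∈W = proj₂ (proj₂ c∈W) (proj₂ (proj₂ c∈B))

  -- Paths sharing a cell have the same source (cells in the same position
  -- by vertex capacity, cells in different positions by their classes).
  shared-cell⇒same-source : ∀ x y {c} → c ∈ pathCells x → c ∈ pathCells y → source x ≡ source y
  shared-cell⇒same-source (b , π) (b′ , π′) = shared
    where
      shared : ∀ {c} → c ∈ pathCells (b , π) → c ∈ pathCells (b′ , π′) → b ≡ b′
      shared (here refl) (here refl) = refl
      shared (here refl) (there (here refl)) = ⊥-elim (B∩P (b∈B π) (peg∈P π′))
      shared (here refl) (there (there (here refl))) = ⊥-elim (B∩W (b∈B π) (white∈W π′))
      shared (there (here refl)) (here refl) = ⊥-elim (B∩P (b∈B π′) (peg∈P π))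
      shared (there (here refl)) (there (here e)) = same-peg⇒same-source π π′ e
      shared (there (here refl)) (there (there (here refl))) = ⊥-elim (W∩P (white∈W π′) (peg∈P π))
      shared (there (there (here refl))) (here refl) = ⊥-elim (B∩W (b∈B π′) (white∈W π))
      shared (there (there (here refl))) (there (here refl)) = ⊥-elim (W∩P (white∈W π) (peg∈P π′))
      shared (there (there (here refl))) (there (there (here e))) =
        same-peg⇒same-source π π′ (same-white⇒same-peg π π′ e)

  pathShape : ∀ x → Σ Tromino λ t → LShape t (peg (proj₂ x)) (source x) (white (proj₂ x))
  pathShape (b , π) = l-tromino b (peg π) (white π) (proj₂ (proj₂ (b∈B π))) (b~peg π)
                        (proj₂ (proj₂ (white∈W π))) (adjacent-sym (peg π) (white π) (peg~white π))

  pathTromino : Route → Tromino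
  pathTromino = proj₁ ∘ pathShape

  pathTromino-pegs : ∀ x → (Tromino.corner (pathTromino x) ∈ P)
                         × (tipH (pathTromino x) ∉ P) × (tipV (pathTromino x) ∉ P)
  pathTromino-pegs (b , π) =
    subst (_∈ P) (sym (proj₁ shape)) (peg∈P π) , lshape-tips (_∉ P) shape (B∩P (b∈B π)) (W∩P (white∈W π))
    where
      shape : LShape (pathTromino (b , π)) (peg π) b (white π)
      shape = proj₂ (pathShape (b , π))

  pathTromino-inside : ∀ x → All (_∈ R) (cells (pathTromino x))
  pathTromino-inside x = All.tabulate (pathCells⊆R x ∘ lshape-⊆ (proj₂ (pathShape x)))

  pathTromino-disjoint : ∀ x y → source x ≢ source y
                       → Disjoint (cells (pathTromino x)) (cells (pathTromino y))
  pathTromino-disjoint x y x≢y (c∈x , c∈y) = x≢y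
    (shared-cell⇒same-source x y (lshape-⊆ (proj₂ (pathShape x)) c∈x) (lshape-⊆ (proj₂ (pathShape y)) c∈y))

  saturated? : Decidable (λ c → 1 ≤ f src (cellv c))
  saturated? c = 1 ≤? f src (cellv c)

  sources : List Cell
  sources = filter saturated? R

  route : ∀ {b} → b ∈ sources → Route
  route {b} b∈ = b , trace (proj₂ (∈-filter⁻ saturated? {xs = R} b∈))

  paths : List Route
  paths = mapWith∈ sources route

  paths-sources : map source paths ≡ sources
  paths-sources = trans (map-mapWith∈ sources route source) (mapWith∈-id sources)

  length-paths : length paths ≡ value R f
  length-paths = begin
    length paths                                          ≡⟨ sym (length-map source paths) ⟩
    length (map source paths)                             ≡⟨ cong length paths-sources ⟩
    length sources                                        ≡⟨ count-positive (f src ∘ cellv) saturated? R at-most-1 ⟩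
    sum (map (f src ∘ cellv) R)                           ≡⟨ cong sum (map-∘ R) ⟩
    sum (map (f src) (map cellv R))                       ≡⟨ cong₂ (λ a b → a + (b + sum (map (f src) (map cellv R))))
                                                                  (sym (nonEdge src src λ ())) (sym (nonEdge src snk λ ())) ⟩
    value R f                                             ∎
    where
      open ≡-Reasoning
      at-most-1 : ∀ {c} → c ∈ R → f src (cellv c) ≤ 1
      at-most-1 {c} c∈R = ≤-trans (term≤sum (λ v → f v (cellv c)) (vertices R) (here refl)) (vertexCap c c∈R)

  tiles : List Tromino
  tiles = map pathTromino paths

  sources-unique : Unique (map source paths)
  sources-unique = subst Unique (sym paths-sources) (Unique.filter⁺ saturated? unique-R)

  tiles-unique : Unique (concatMap cells tiles)
  tiles-unique = subst Unique (sym (concatMap-map cells pathTromino paths))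
    (concatMap-unique source (cells ∘ pathTromino) {paths} (tromino-cells-unique ∘ pathTromino)
      pathTromino-disjoint sources-unique)

  tiles-inside : ∀ {t} → t ∈ tiles → All (_∈ R) (cells t)
  tiles-inside = image-property (λ t → All (_∈ R) (cells t)) pathTromino pathTromino-inside

  tiles-pegs : ∀ {t} → t ∈ tiles → (Tromino.corner t ∈ P) × (tipH t ∉ P) × (tipV t ∉ P)
  tiles-pegs = image-property (λ t → (Tromino.corner t ∈ P) × (tipH t ∉ P) × (tipV t ∉ P))
                 pathTromino pathTromino-pegs

length-tromino-cells : ∀ T → length (concatMap cells T) ≡ 3 * length T
length-tromino-cells [] = refl
length-tromino-cells (t ∷ T) = trans (cong (λ n → 3 + n) (length-tromino-cells T)) (sym (*-suc 3 (length T)))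

lemma3p3 : (R P : List Cell) (k : ℕ) → IsRegion R → length R ≡ 3 * k
    → Unique P → (∀ {c} → c ∈ P → c ∈ R) → length P ≡ k
    → MaxFlowValue R P k → HasPCover R P
lemma3p3 R P k (unique-R , _) |R|≡3k _ _ _ ((f , isFlow , value≡k) , _) =
  tiles , tiles-unique , tiles-inside , covers , tiles-pegs
  where
    open RegionFlow R P f isFlow unique-R

    covered⊆R : concatMap cells tiles ⊆ R
    covered⊆R c∈ with find (∈-concatMap⁻ cells c∈)
    ... | t , t∈ , c∈t = All.lookup (tiles-inside t∈) c∈t

    |R|≤|covered| : length R ≤ length (concatMap cells tiles)
    |R|≤|covered| = ≤-reflexive (begin
      length R                         ≡⟨ |R|≡3k ⟩
      3 * k                            ≡⟨ cong (3 *_) (trans (sym value≡k) (sym length-paths)) ⟩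
      3 * length paths                 ≡⟨ cong (3 *_) (sym (length-map pathTromino paths)) ⟩
      3 * length tiles                 ≡⟨ sym (length-tromino-cells tiles) ⟩
      length (concatMap cells tiles)   ∎)
      where open ≡-Reasoning

    covers : ∀ {c} → c ∈ R → Σ Tromino (λ t → t ∈ tiles × c ∈ cells t)
    covers c∈R = find (∈-concatMap⁻ cells (unique-long-⊇ _≟ᶜ_ tiles-unique covered⊆R |R|≤|covered| c∈R))
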